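{- Let $n\ge 2$ and $x^\Lambda\partial_k\in\mathcal{B}$. If $\mathrm{lev}_i(x^\Lambda\partial_k)\le i$ for an integer $i\ge -1$, then $\mathrm{lev}_{i+(n-1)}(x^\Lambda\partial_k)\le i+(n-1)$. In particular, for every integer $h\ge 1$: $\mathrm{lev}_i(x^\Lambda\partial_k)>i$ for all integers $-1\le i\le h(n-1)$ if and only if $\mathrm{lev}_i(x^\Lambda\partial_k)>i$ for all integers $i$ with $(h-1)(n-1)+1\le i\le h(n-1)$.
   Context: Let $n\ge 2$ be an integer. A partition is a sequence $\Lambda=(\lambda_t)_{t\ge 1}$ of non-negative integers with finite support; $\mathrm{wt}(\Lambda)=\sum_t t\lambda_t$; $x^\Lambda=\prod_t x_t^{\lambda_t}$ (monomial in commuting indeterminates), $\deg(x^\Lambda)=\sum_t\lambda_t$. $\mathrm{Part}(j)$ is the set of partitions with $\lambda_t=0$ for $t>j$; $\partial_k$ is the partial derivative with respect to $x_k$. Let $\mathcal{B}=\{x^\Lambda\partial_k:1\le k\le n,\ \Lambda\in\mathrm{Part}(k-1)\}$. For an integer $i\ge -1$ let $r_i\in\{1,\dots,n-1\}$ with $i\equiv r_i\pmod{n-1}$ and $h_i=\lfloor (i-1)/(n-1)\rfloor+1$. For $x^\Lambda\partial_k\in\mathcal{B}$ define $\mathrm{WD}(x^\Lambda\partial_k)=\mathrm{wt}(\Lambda)-\deg(x^\Lambda)+n-k$ and $\mathrm{lev}_i(x^\Lambda\partial_k)=h_i\,\mathrm{WD}(x^\Lambda\partial_k)+\deg(x^\Lambda)-1$.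 -}

module Defs where

open import Data.Nat as ℕ using (ℕ; zero; suc)
open import Data.Integer using (ℤ; +_; _+_; _-_; _*_; _/ℕ_; -[1+_])
open import Data.Vec using (Vec; []; _∷_)

-- A partition Λ ∈ Part(j) is represented by the vector (λ_1, …, λ_j) ∈ ℕ^j
-- (entries λ_t for t > j are zero by definition of Part(j)).

wtFrom : ∀ {j} → ℕ → Vec ℕ j → ℕ
wtFrom s []       = 0
wtFrom s (x ∷ xs) = s ℕ.* x ℕ.+ wtFrom (suc s) xs

wt : ∀ {j} → Vec ℕ j → ℕ
wt = wtFrom 1

deg : ∀ {j} → Vec ℕ j → ℕ
deg []       = 0
deg (x ∷ xs) = x ℕ.+ deg xs

WD : (n k : ℕ) → Vec ℕ (k ℕ.∸ 1) → ℤ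
WD n k Λ = + wt Λ - + deg Λ + + n - + k

-- h_i = ⌊(i-1)/(n-1)⌋ + 1  (floor division; n ≥ 2 in all uses,
-- the value for n ≤ 1 is an irrelevant junk value 0)
hIdx : ℕ → ℤ → ℤ
hIdx n i with n ℕ.∸ 1
... | zero  = + 0
... | suc d = ((i - + 1) /ℕ suc d) + + 1

lev : (n : ℕ) → ℤ → (k : ℕ) → Vec ℕ (k ℕ.∸ 1) → ℤ
lev n i k Λ = hIdx n i * WD n k Λ + + deg Λ - + 1

-- Shifting i by n - 1 raises h_i by exactly one, so lev_{i+(n-1)} = lev_i + WD.
-- When WD ≤ n - 1 the inequality lev_i ≤ i is therefore preserved. When WD ≥ n the
-- bound wt(Λ) ≤ (k - 1) deg(Λ) forces deg(Λ) ≥ 2 and k ≥ 3, hence n ≥ 3 and h_i ≥ 0,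
-- and then lev_i ≥ h_i (n - 1) + 1 > i, so the hypothesis lev_i ≤ i never holds.
-- Contrapositively i + (n - 1) < lev_{i+(n-1)} implies i < lev_i, which propagates
-- the inequality down from the window ((h - 1)(n - 1), h(n - 1)] to all of [-1, h(n - 1)].
module Submission where

open import Defs
open import Data.Nat as ℕ using (ℕ; zero; suc; z≤n; s≤s)
import Data.Nat.Properties as ℕ
open import Data.Integer
  using (ℤ; +_; -[1+_]; _+_; _-_; _*_; _≤_; _<_; _≤?_; _<?_; +≤+; +<+; -≤+; -≤-; _/ℕ_)
  renaming (suc to sucℤ)
open import Data.Integer.Properties
open import Data.Integer.DivMod using ([n/ℕd]*d≤n; n<s[n/ℕd]*d)
open import Data.Integer.Tactic.RingSolver using (solve-∀)
open import Data.Vec using (Vec; []; _∷_)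
open import Data.Product using (_×_; _,_)
open import Function using (_∘_)
open import Function.Bundles using (_⇔_; mk⇔)
open import Relation.Nullary using (yes; no; contradiction)
open import Relation.Binary.PropositionalEquality
  using (_≡_; refl; sym; cong; subst; subst₂; module ≡-Reasoning)

i<1+j⇒i≤j : ∀ {i j} → i < sucℤ j → i ≤ j
i<1+j⇒i≤j {j = j} i<1+j = subst (_ ≤_) (pred-suc j) (i<j⇒i≤pred[j] i<1+j)

i<i+1+n : ∀ i n → i < i + + suc n
i<i+1+n i n = subst (_< i + + suc n) (+-identityʳ i) (+-monoʳ-< i (+<+ (s≤s z≤n)))

/ℕ-unique : ∀ n d .{{_ : ℕ.NonZero d}} q → q * + d ≤ n → n < sucℤ q * + d → n /ℕ d ≡ q
/ℕ-unique n d q qd≤n n<[1+q]d = ≤-antisym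
  (i<1+j⇒i≤j (*-cancelʳ-<-nonNeg (+ d) (≤-<-trans ([n/ℕd]*d≤n n d) n<[1+q]d)))
  (i<1+j⇒i≤j (*-cancelʳ-<-nonNeg (+ d) (≤-<-trans qd≤n (n<s[n/ℕd]*d n d))))

[n+d]/ℕd≡1+[n/ℕd] : ∀ n d .{{_ : ℕ.NonZero d}} → (n + + d) /ℕ d ≡ sucℤ (n /ℕ d)
[n+d]/ℕd≡1+[n/ℕd] n d = /ℕ-unique (n + + d) d (sucℤ q)
  (subst (_≤ n + + d) (sym (shift q (+ d))) (+-monoˡ-≤ (+ d) ([n/ℕd]*d≤n n d)))
  (subst (n + + d <_) (sym (shift (sucℤ q) (+ d))) (+-monoˡ-< (+ d) (n<s[n/ℕd]*d n d)))
  where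
  q : ℤ
  q = n /ℕ d
  shift : ∀ q d → (+ 1 + q) * d ≡ q * d + d
  shift = solve-∀

-1≤i*j⇒0≤i : ∀ i j → 2 ℕ.≤ j → -[1+ 0 ] ≤ i * + j → + 0 ≤ i
-1≤i*j⇒0≤i (+ m)    _ _             _      = +≤+ z≤n
-1≤i*j⇒0≤i -[1+ m ] _ (s≤s (s≤s _)) (-≤- ())

wtFrom≤ : ∀ {j} s (xs : Vec ℕ j) → wtFrom (suc s) xs ℕ.≤ (s ℕ.+ j) ℕ.* deg xs
wtFrom≤ s [] = z≤n
wtFrom≤ {suc j} s (x ∷ xs) = begin
  suc s ℕ.* x ℕ.+ wtFrom (suc (suc s)) xs
    ≤⟨ ℕ.+-mono-≤ (ℕ.*-monoˡ-≤ x (ℕ.≤-trans (ℕ.m≤m+n (suc s) j) (ℕ.≤-reflexive (sym (ℕ.+-suc s j)))))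
                  (wtFrom≤ (suc s) xs) ⟩
  (s ℕ.+ suc j) ℕ.* x ℕ.+ (suc s ℕ.+ j) ℕ.* deg xs
    ≡⟨ cong (λ c → (s ℕ.+ suc j) ℕ.* x ℕ.+ c ℕ.* deg xs) (sym (ℕ.+-suc s j)) ⟩
  (s ℕ.+ suc j) ℕ.* x ℕ.+ (s ℕ.+ suc j) ℕ.* deg xs
    ≡⟨ ℕ.*-distribˡ-+ (s ℕ.+ suc j) x (deg xs) ⟨
  (s ℕ.+ suc j) ℕ.* deg (x ∷ xs) ∎
  where open ℕ.≤-Reasoning

e+1+k≤k*e⇒2≤e×2≤k : ∀ k e → e ℕ.+ suc k ℕ.≤ k ℕ.* e → 2 ℕ.≤ e × 2 ℕ.≤ k
e+1+k≤k*e⇒2≤e×2≤k k zero p rewrite ℕ.*-zeroʳ k = contradiction p λ ()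
e+1+k≤k*e⇒2≤e×2≤k k (suc zero) p rewrite ℕ.*-identityʳ k =
  contradiction (ℕ.≤-trans (ℕ.n≤1+n (suc k)) p) (ℕ.<-irrefl refl)
e+1+k≤k*e⇒2≤e×2≤k zero (suc (suc e)) ()
e+1+k≤k*e⇒2≤e×2≤k (suc zero) (suc (suc e)) p =
  contradiction (ℕ.+-cancelˡ-≤ (suc (suc e)) 2 0 p) λ ()
e+1+k≤k*e⇒2≤e×2≤k (suc (suc k)) (suc (suc e)) _ = s≤s (s≤s z≤n) , s≤s (s≤s z≤n)

WD≤n-1 : ∀ m k (Λ : Vec ℕ (k ℕ.∸ 1)) → wt Λ ℕ.< deg Λ ℕ.+ k → WD (suc m) k Λ ≤ + m
WD≤n-1 m k Λ wt<deg+k =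
  subst (_≤ + m) (sym (regroup (+ wt Λ) (+ deg Λ) (+ m) (+ k)))
    (+-monoˡ-≤ (+ m) (i≤j⇒i-j≤0 (+≤+ wt<deg+k)))
  where
  regroup : ∀ w e m k → w - e + (+ 1 + m) - k ≡ (+ 1 + w) - (e + k) + m
  regroup = solve-∀

n-1<WD⇒2≤deg×3≤k : ∀ m k (Λ : Vec ℕ (k ℕ.∸ 1)) → 1 ℕ.≤ k → + m < WD (suc m) k Λ →
                    2 ℕ.≤ deg Λ × 3 ℕ.≤ k
n-1<WD⇒2≤deg×3≤k m (suc k) Λ _ m<WD with e+1+k≤k*e⇒2≤e×2≤k k (deg Λ) deg+k≤k*deg
  where
  deg+k≤k*deg : deg Λ ℕ.+ suc k ℕ.≤ k ℕ.* deg Λ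
  deg+k≤k*deg = ℕ.≤-trans (ℕ.≮⇒≥ (<⇒≱ m<WD ∘ WD≤n-1 m (suc k) Λ)) (wtFrom≤ 0 Λ)
... | 2≤deg , 2≤k = 2≤deg , s≤s 2≤k

i≤h*z⇒i<h*W+e-1 : ∀ {h i W} z e → + 0 ≤ h → z ≤ W → 2 ℕ.≤ e → i ≤ h * z → i < h * W + + e - + 1
i≤h*z⇒i<h*W+e-1 z (suc zero) _ _ (s≤s ()) _
i≤h*z⇒i<h*W+e-1 {+ m} {i} {W} z (suc (suc e)) _ z≤W _ i≤hz =
  ≤-<-trans (≤-trans i≤hz (*-monoˡ-≤-nonNeg (+ m) z≤W))
    (subst (+ m * W <_) (regroup (+ m * W) (+ e)) (i<i+1+n (+ m * W) e))
  where
  regroup : ∀ x e → x + (+ 1 + e) ≡ x + (+ 2 + e) - + 1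
  regroup = solve-∀

module _ {P : ℤ → Set} (lo u : ℤ) (z : ℕ)
         (step : ∀ i → lo ≤ i → P (i + + z) → P i)
         (window : ∀ i → u < i → i ≤ u + + z → P i) where

  window⇒interval : ∀ f → u < lo + + f * + z → ∀ i → lo ≤ i → i ≤ u + + z → P i
  window⇒interval f u<lo+fz i lo≤i i≤u+z =
    descend f i lo≤i i≤u+z (<-≤-trans u<lo+fz (+-monoˡ-≤ (+ f * + z) lo≤i))
    where
    descend : ∀ f i → lo ≤ i → i ≤ u + + z → u < i + + f * + z → P i
    descend zero i _ i≤u+z u<i+0 = window i (subst (u <_) (drop i (+ z)) u<i+0) i≤u+z
      where
      drop : ∀ i z → i + + 0 * z ≡ i
      drop = solve-∀
    descend (suc f) i lo≤i i≤u+z u<i+[1+f]z with u <? i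
    ... | yes u<i = window i u<i i≤u+z
    ... | no u≮i = step i lo≤i (descend f (i + + z)
            (≤-trans lo≤i (i≤i+j i (+ z)))
            (+-monoˡ-≤ (+ z) (≮⇒≥ u≮i))
            (subst (u <_) (regroup i (+ f) (+ z)) u<i+[1+f]z))
      where
      regroup : ∀ i f z → i + (+ 1 + f) * z ≡ i + z + f * z
      regroup = solve-∀

module _ (d : ℕ) where
  private
    n : ℕ
    n = suc (suc d)
    z : ℤ
    z = + suc d

  hIdx-shift : ∀ i → hIdx n (i + z) ≡ hIdx n i + + 1
  hIdx-shift i = begin
    (i + z - + 1) /ℕ suc d + + 1   ≡⟨ cong (λ x → x /ℕ suc d + + 1) (regroup i z) ⟩
    (i - + 1 + z) /ℕ suc d + + 1   ≡⟨ cong (_+ + 1) ([n+d]/ℕd≡1+[n/ℕd] (i - + 1) (suc d)) ⟩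
    + 1 + (i - + 1) /ℕ suc d + + 1 ≡⟨ cong (_+ + 1) (+-comm (+ 1) ((i - + 1) /ℕ suc d)) ⟩
    hIdx n i + + 1                 ∎
    where
    open ≡-Reasoning
    regroup : ∀ i z → i + z - + 1 ≡ i - + 1 + z
    regroup = solve-∀

  i≤hIdx*[n-1] : ∀ i → i ≤ hIdx n i * z
  i≤hIdx*[n-1] i = subst₂ _≤_ (cancel i) (cong (_* z) (+-comm (+ 1) ((i - + 1) /ℕ suc d)))
    (i<j⇒suc[i]≤j (n<s[n/ℕd]*d (i - + 1) (suc d)))
    where
    cancel : ∀ i → + 1 + (i - + 1) ≡ i
    cancel = solve-∀

  lev-shift : ∀ k (Λ : Vec ℕ (k ℕ.∸ 1)) i → lev n (i + z) k Λ ≡ lev n i k Λ + WD n k Λ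
  lev-shift k Λ i = begin
    hIdx n (i + z) * W + e - + 1    ≡⟨ cong (λ h → h * W + e - + 1) (hIdx-shift i) ⟩
    (hIdx n i + + 1) * W + e - + 1  ≡⟨ regroup (hIdx n i) W e ⟩
    lev n i k Λ + W                 ∎
    where
    open ≡-Reasoning
    W e : ℤ
    W = WD n k Λ
    e = + deg Λ
    regroup : ∀ h W e → (h + + 1) * W + e - + 1 ≡ h * W + e - + 1 + W
    regroup = solve-∀

  lev≤-shift : ∀ k → 1 ℕ.≤ k → k ℕ.≤ n → (Λ : Vec ℕ (k ℕ.∸ 1)) →
               ∀ i → -[1+ 0 ] ≤ i → lev n i k Λ ≤ i → lev n (i + z) k Λ ≤ i + z
  lev≤-shift k 1≤k k≤n Λ i -1≤i lev≤i with WD n k Λ ≤? z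
  ... | yes W≤z = subst (_≤ i + z) (sym (lev-shift k Λ i)) (+-mono-≤ lev≤i W≤z)
  ... | no W≰z = contradiction lev≤i (<⇒≱ i<lev)
    where
    z<W : z < WD n k Λ
    z<W = ≰⇒> W≰z
    i<lev : i < lev n i k Λ
    i<lev with n-1<WD⇒2≤deg×3≤k (suc d) k Λ 1≤k z<W
    ... | 2≤deg , 3≤k = i≤h*z⇒i<h*W+e-1 z (deg Λ) 0≤h (<⇒≤ z<W) 2≤deg (i≤hIdx*[n-1] i)
      where
      0≤h : + 0 ≤ hIdx n i
      0≤h = -1≤i*j⇒0≤i (hIdx n i) (suc d) (ℕ.≤-pred (ℕ.≤-trans 3≤k k≤n))
                        (≤-trans -1≤i (i≤hIdx*[n-1] i))

  i<lev-descends : ∀ k → 1 ℕ.≤ k → k ℕ.≤ n → (Λ : Vec ℕ (k ℕ.∸ 1)) →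
                   ∀ i → -[1+ 0 ] ≤ i → i + z < lev n (i + z) k Λ → i < lev n i k Λ
  i<lev-descends k 1≤k k≤n Λ i -1≤i i+z<lev =
    ≰⇒> (<⇒≱ i+z<lev ∘ lev≤-shift k 1≤k k≤n Λ i -1≤i)

  i<lev-interval⇔window : ∀ k → 1 ℕ.≤ k → k ℕ.≤ n → (Λ : Vec ℕ (k ℕ.∸ 1)) → ∀ h → + 1 ≤ h →
    ((i : ℤ) → -[1+ 0 ] ≤ i → i ≤ h * z → i < lev n i k Λ) ⇔
    ((i : ℤ) → (h - + 1) * z + + 1 ≤ i → i ≤ h * z → i < lev n i k Λ)
  i<lev-interval⇔window k 1≤k k≤n Λ (+ suc m) (+≤+ (s≤s _)) = mk⇔
    (λ interval i u+1≤i → interval i (≤-trans -1≤u+1 u+1≤i))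
    (λ window i -1≤i i≤hz → window⇒interval -[1+ 0 ] u (suc d) (i<lev-descends k 1≤k k≤n Λ)
       (λ j u<j j≤u+z → window j (subst (_≤ j) (+-comm (+ 1) u) (i<j⇒suc[i]≤j u<j))
                                  (≤-trans j≤u+z (≤-reflexive u+z≡h*z)))
       (suc (suc m)) u<-1+[2+m]z i -1≤i (≤-trans i≤hz (≤-reflexive (sym u+z≡h*z))))
    where
    u : ℤ
    u = + m * z
    -1≤u+1 : -[1+ 0 ] ≤ u + + 1
    -1≤u+1 = subst (λ x → -[1+ 0 ] ≤ x + + 1) (pos-* m (suc d)) -≤+
    u+z≡h*z : u + z ≡ + suc m * z
    u+z≡h*z = top (+ m) z
      where
      top : ∀ m z → m * z + z ≡ (+ 1 + m) * z
      top = solve-∀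
    -- m + 2 descent steps rather than m + 1, so that this also holds for n = 2.
    fuel : ∀ m d → -[1+ 0 ] + (+ 2 + m) * (+ 1 + d) ≡ m * (+ 1 + d) + (+ 1 + (d + d))
    fuel = solve-∀
    u<-1+[2+m]z : u < -[1+ 0 ] + + suc (suc m) * z
    u<-1+[2+m]z = subst (u <_) (sym (fuel (+ m) (+ d))) (i<i+1+n u (d ℕ.+ d))

lemma2p6 : (n : ℕ) → 2 ℕ.≤ n → (k : ℕ) → 1 ℕ.≤ k → k ℕ.≤ n → (Λ : Vec ℕ (k ℕ.∸ 1)) →
    ((i : ℤ) → -[1+ 0 ] ≤ i → lev n i k Λ ≤ i →
      lev n (i + + (n ℕ.∸ 1)) k Λ ≤ i + + (n ℕ.∸ 1))
    ×
    ((h : ℤ) → + 1 ≤ h →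
      (((i : ℤ) → -[1+ 0 ] ≤ i → i ≤ h * + (n ℕ.∸ 1) → i < lev n i k Λ)
        ⇔
       ((i : ℤ) → (h - + 1) * + (n ℕ.∸ 1) + + 1 ≤ i → i ≤ h * + (n ℕ.∸ 1) → i < lev n i k Λ)))
lemma2p6 (suc zero)    (s≤s ()) _ _ _ _
lemma2p6 (suc (suc d)) _        k 1≤k k≤n Λ =
  lev≤-shift d k 1≤k k≤n Λ , i<lev-interval⇔window d k 1≤k k≤n Λ
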